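{- Let $n$ be a positive integer, let $R$ be a commutative ring, and let $u_{i,j}\in R$ for each $i\in[n]$ and $j\in[n+1]$. Then $$\sum_{k=1}^n\det\left(u_{i,\,j+[k=i]}\right)_{i,j\in[n]}=\det\left(u_{i,\,j+[n=j]}\right)_{i,j\in[n]}.$$
   Context: $[m]=\{1,\ldots,m\}$. $[X]$ denotes the Iverson bracket: $1$ if the statement $X$ is true, $0$ otherwise. $(a_{i,j})_{i,j\in[n]}$ is the $n\times n$ matrix with $(i,j)$-entry $a_{i,j}$. -}

module Defs where

open import Level using (Level)
open import Data.Nat using (ℕ; zero; suc)
open import Data.Fin using (Fin; zero; suc; inject₁; fromℕ; punchIn; toℕ)
open import Data.Bool using (Bool; if_then_else_)
open import Algebra.Bundles using (CommutativeRing)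

-- j + [b] for j ∈ [n], as an element of [n+1] (0-based: Fin n ↪ Fin (suc n))
shift : ∀ {n} → Fin n → Bool → Fin (suc n)
shift j b = if b then suc j else inject₁ j

module _ {c ℓ : Level} (R : CommutativeRing c ℓ) where
  open CommutativeRing R using (Carrier; _+_; _*_; -_; 0#; 1#)

  Σ : ∀ {n} → (Fin n → Carrier) → Carrier
  Σ {zero}  f = 0#
  Σ {suc n} f = f zero + Σ (λ i → f (suc i))

  sgn : ℕ → Carrier
  sgn zero = 1#
  sgn (suc k) = - sgn k

  det : ∀ {n} → (Fin n → Fin n → Carrier) → Carrier
  det {zero}  A = 1#
  det {suc n} A =
    Σ (λ j → sgn (toℕ j) * (A zero j * det (λ r s → A (suc r) (punchIn j s))))

{-# OPTIONS --safe #-}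
module Submission where

-- Let A and B be the square matrices formed by the first and by the last n columns of u.
-- The k-th summand on the left is det A with its k-th row replaced by that of B, and the
-- right-hand side is det A with its last column replaced by that of B. Expanding along the
-- first row and inducting on the size shows
--   Σₖ det (A with row k from B) = Σ_c det (A with column c from B)
-- (both are the derivative of det (A + tB) at t = 0). For every c but the last, the matrix
-- "A with column c from B" has columns c and c + 1 both equal to column c + 1 of u, so its
-- determinant vanishes; only the last term survives.

open import Defs
open import Level using (Level)
open import Algebra.Bundles using (CommutativeRing)
open import Data.Nat using (ℕ; zero; suc)
import Data.Nat.Properties as ℕ
open import Data.Fin using (Fin; zero; suc; fromℕ; inject₁; punchIn; toℕ)
open import Data.Fin.Properties using (_≟_; punchIn-injective; punchInᵢ≢i; suc-injective; toℕ-inject₁)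
open import Data.Bool using (Bool; if_then_else_)
open import Data.Bool.Properties using (if-float; if-cong)
open import Data.Product using (∃; _×_; _,_)
open import Data.Empty using (⊥-elim)
open import Function using (_∘_; mk⇔)
open import Relation.Nullary using (does; yes; no)
open import Relation.Nullary.Decidable using (dec-true; dec-false; does-⇔)
open import Relation.Binary.PropositionalEquality as ≡ using (_≡_; _≢_; cong)

inject₁≢suc : ∀ {n} (i : Fin n) → inject₁ i ≢ suc i
inject₁≢suc i eq = ℕ.1+n≢n (≡.sym (≡.trans (≡.sym (toℕ-inject₁ i)) (cong toℕ eq)))

punchIn-inject₁-self : ∀ {n} (k : Fin n) → punchIn (inject₁ k) k ≡ suc k
punchIn-inject₁-self zero    = ≡.refl
punchIn-inject₁-self (suc k) = cong suc (punchIn-inject₁-self k)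

punchIn-suc-self : ∀ {n} (k : Fin n) → punchIn (suc k) k ≡ inject₁ k
punchIn-suc-self zero    = ≡.refl
punchIn-suc-self (suc k) = cong suc (punchIn-suc-self k)

punchIn-inject₁≡punchIn-suc : ∀ {n} {k s : Fin n} → s ≢ k → punchIn (inject₁ k) s ≡ punchIn (suc k) s
punchIn-inject₁≡punchIn-suc {k = zero}  {zero}  s≢k = ⊥-elim (s≢k ≡.refl)
punchIn-inject₁≡punchIn-suc {k = zero}  {suc s} _   = ≡.refl
punchIn-inject₁≡punchIn-suc {k = suc k} {zero}  _   = ≡.refl
punchIn-inject₁≡punchIn-suc {k = suc k} {suc s} s≢k = cong suc (punchIn-inject₁≡punchIn-suc (s≢k ∘ cong suc))

punchIn-adjacent : ∀ {n} (j : Fin (suc (suc n))) (k : Fin (suc n)) → j ≢ inject₁ k → j ≢ suc k →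
                   ∃ λ (k′ : Fin n) → punchIn j (inject₁ k′) ≡ inject₁ k × punchIn j (suc k′) ≡ suc k
punchIn-adjacent zero          zero    j≢k _     = ⊥-elim (j≢k ≡.refl)
punchIn-adjacent zero          (suc k) _   _     = k , ≡.refl , ≡.refl
punchIn-adjacent (suc zero)    zero    _   j≢1+k = ⊥-elim (j≢1+k ≡.refl)
punchIn-adjacent {suc n} (suc (suc j)) zero _ _  = zero , ≡.refl , ≡.refl
punchIn-adjacent {suc n} (suc j) (suc k) j≢k j≢1+k
  with k′ , eq₁ , eq₂ ← punchIn-adjacent j k (j≢k ∘ cong suc) (j≢1+k ∘ cong suc)
  = suc k′ , cong suc eq₁ , cong suc eq₂

module _ {c ℓ : Level} (R : CommutativeRing c ℓ) where
  open CommutativeRing R hiding (zero)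
  open import Algebra.Properties.Semiring.Sum semiring
  open import Algebra.Properties.Ring ring using (-‿distribˡ-*)
  open import Relation.Binary.Reasoning.Setoid setoid

  Σ≡sum : ∀ {n} (f : Fin n → Carrier) → Σ R f ≡ sum f
  Σ≡sum {zero}  f = ≡.refl
  Σ≡sum {suc n} f = cong (f zero +_) (Σ≡sum (f ∘ suc))

  Matrix : ℕ → Set c
  Matrix n = Fin n → Fin n → Carrier

  minor : ∀ {n} → Fin (suc n) → Matrix (suc n) → Matrix n
  minor j A r s = A (suc r) (punchIn j s)

  cofactorTerm : ∀ {n} → Matrix (suc n) → Fin (suc n) → Carrier
  cofactorTerm A j = sgn R (toℕ j) * (A zero j * det R (minor j A))

  det-expand : ∀ {n} (A : Matrix (suc n)) → det R A ≡ sum (cofactorTerm A)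
  det-expand A = Σ≡sum (cofactorTerm A)

  det-cong : ∀ {n} {A B : Matrix n} → (∀ i j → A i j ≈ B i j) → det R A ≈ det R B
  det-cong {zero}  _   = refl
  det-cong {suc n} {A} {B} A≈B = begin
    det R A               ≡⟨ det-expand A ⟩
    sum (cofactorTerm A)  ≈⟨ sum-cong-≋ {x = cofactorTerm A} (λ j → *-congˡ (*-cong (A≈B zero j) (det-cong (minor-cong j)))) ⟩
    sum (cofactorTerm B)  ≡⟨ det-expand B ⟨
    det R B               ∎
    where
    minor-cong : ∀ j r s → minor j A r s ≈ minor j B r s
    minor-cong j r s = A≈B (suc r) (punchIn j s)

  sum-zero : ∀ {n} {f : Fin n → Carrier} → (∀ i → f i ≈ 0#) → sum f ≈ 0#
  sum-zero {n} f≈0 = trans (sum-cong-≋ f≈0) (sum-replicate-zero n)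

  sum-adjacent : ∀ {n} (f : Fin (suc (suc n)) → Carrier) (k : Fin (suc n)) →
                 (∀ j → j ≢ inject₁ k → j ≢ suc k → f j ≈ 0#) → sum f ≈ f (inject₁ k) + f (suc k)
  sum-adjacent {n} f zero f≈0 = begin
    f zero + (f (suc zero) + sum {n} (λ j → f (suc (suc j))))
      ≈⟨ +-assoc _ _ _ ⟨
    (f zero + f (suc zero)) + sum {n} (λ j → f (suc (suc j)))
      ≈⟨ +-congˡ (sum-zero (λ j → f≈0 (suc (suc j)) (λ ()) (λ ()))) ⟩
    (f zero + f (suc zero)) + 0#
      ≈⟨ +-identityʳ _ ⟩
    f zero + f (suc zero)
      ∎
  sum-adjacent {suc n} f (suc k) f≈0 = begin
    f zero + sum (λ j → f (suc j))
      ≈⟨ +-cong (f≈0 zero (λ ()) (λ ())) (sum-adjacent (λ j → f (suc j)) k f∘suc≈0) ⟩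
    0# + (f (suc (inject₁ k)) + f (suc (suc k)))
      ≈⟨ +-identityˡ _ ⟩
    f (suc (inject₁ k)) + f (suc (suc k))
      ∎
    where
    f∘suc≈0 : ∀ j → j ≢ inject₁ k → j ≢ suc k → f (suc j) ≈ 0#
    f∘suc≈0 j j≢k j≢1+k = f≈0 (suc j) (j≢k ∘ suc-injective) (j≢1+k ∘ suc-injective)

  AdjacentColumnsEqual : ∀ {n} → Matrix (suc n) → Fin n → Set ℓ
  AdjacentColumnsEqual A k = ∀ i → A i (inject₁ k) ≈ A i (suc k)

  minor-inject₁≈minor-suc : ∀ {n} (A : Matrix (suc n)) (k : Fin n) → AdjacentColumnsEqual A k →
                            ∀ r s → minor (inject₁ k) A r s ≈ minor (suc k) A r s
  minor-inject₁≈minor-suc A k columns≈ r s with s ≟ k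
  ... | no s≢k     = reflexive (cong (A (suc r)) (punchIn-inject₁≡punchIn-suc s≢k))
  ... | yes ≡.refl = begin
    A (suc r) (punchIn (inject₁ s) s)  ≡⟨ cong (A (suc r)) (punchIn-inject₁-self s) ⟩
    A (suc r) (suc s)                  ≈⟨ columns≈ (suc r) ⟨
    A (suc r) (inject₁ s)              ≡⟨ cong (A (suc r)) (punchIn-suc-self s) ⟨
    A (suc r) (punchIn (suc s) s)      ∎

  minor-adjacentColumnsEqual : ∀ {n} (A : Matrix (suc (suc n))) (k : Fin (suc n)) → AdjacentColumnsEqual A k →
                               ∀ j → j ≢ inject₁ k → j ≢ suc k → ∃ (AdjacentColumnsEqual (minor j A))
  minor-adjacentColumnsEqual A k columns≈ j j≢k j≢1+k
    with k′ , eq₁ , eq₂ ← punchIn-adjacent j k j≢k j≢1+k = k′ , λ r → begin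
      A (suc r) (punchIn j (inject₁ k′))  ≡⟨ cong (A (suc r)) eq₁ ⟩
      A (suc r) (inject₁ k)               ≈⟨ columns≈ (suc r) ⟩
      A (suc r) (suc k)                   ≡⟨ cong (A (suc r)) eq₂ ⟨
      A (suc r) (punchIn j (suc k′))      ∎

  det-adjacentColumnsEqual : ∀ {n} (A : Matrix (suc n)) (k : Fin n) → AdjacentColumnsEqual A k → det R A ≈ 0#
  det-adjacentColumnsEqual {suc n} A k columns≈ = begin
    det R A
      ≡⟨ det-expand A ⟩
    sum (cofactorTerm A)
      ≈⟨ sum-adjacent (cofactorTerm A) k cofactorTerm≈0 ⟩
    cofactorTerm A (inject₁ k) + cofactorTerm A (suc k)
      ≈⟨ +-cong (*-cong sgn-inject₁ pair≈) (sym (-‿distribˡ-* _ _)) ⟩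
    sgn R (toℕ k) * X + - (sgn R (toℕ k) * X)
      ≈⟨ -‿inverseʳ _ ⟩
    0#
      ∎
    where
    X : Carrier
    X = A zero (suc k) * det R (minor (suc k) A)
    sgn-inject₁ : sgn R (toℕ (inject₁ k)) ≈ sgn R (toℕ k)
    sgn-inject₁ = reflexive (cong (sgn R) (toℕ-inject₁ k))
    pair≈ : A zero (inject₁ k) * det R (minor (inject₁ k) A) ≈ X
    pair≈ = *-cong (columns≈ zero) (det-cong (minor-inject₁≈minor-suc A k columns≈))
    cofactorTerm≈0 : ∀ j → j ≢ inject₁ k → j ≢ suc k → cofactorTerm A j ≈ 0#
    cofactorTerm≈0 j j≢k j≢1+k with k′ , minor≈ ← minor-adjacentColumnsEqual A k columns≈ j j≢k j≢1+k =
      trans (*-congˡ (trans (*-congˡ (det-adjacentColumnsEqual (minor j A) k′ minor≈)) (zeroʳ _))) (zeroʳ _)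

  *-*-distribˡ-sum : ∀ {n} x y (f : Fin n → Carrier) → x * (y * sum f) ≈ sum (λ i → x * (y * f i))
  *-*-distribˡ-sum x y f = trans (*-congˡ (*-distribˡ-sum y f)) (*-distribˡ-sum x (λ i → y * f i))

  replaceRow replaceCol : ∀ {n} → Matrix n → Matrix n → Fin n → Matrix n
  replaceRow A B k i j = if does (k ≟ i) then B i j else A i j
  replaceCol A B c i j = if does (c ≟ j) then B i j else A i j

  -- Both Σₖ det (replaceRow A B k) and Σₖ det (replaceCol A B k) expand along the first row
  -- into this shape, with S j the corresponding sum for the minors at column j.
  splitExpansion : ∀ {n} → Matrix (suc n) → Matrix (suc n) → (Fin (suc n) → Carrier) → Carrier
  splitExpansion A B S = sum (λ j → sgn R (toℕ j) * (B zero j * det R (minor j A)))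
                       + sum (λ j → sgn R (toℕ j) * (A zero j * S j))

  splitExpansion-cong : ∀ {n} (A B : Matrix (suc n)) {S T : Fin (suc n) → Carrier} →
                        (∀ j → S j ≈ T j) → splitExpansion A B S ≈ splitExpansion A B T
  splitExpansion-cong A B {S} {T} S≈T = +-congˡ (sum-cong-≋
    {x = λ j → sgn R (toℕ j) * (A zero j * S j)} {y = λ j → sgn R (toℕ j) * (A zero j * T j)}
    (λ j → *-congˡ (*-congˡ (S≈T j))))

  sum-det-replaceRow-expand : ∀ {n} (A B : Matrix (suc n)) →
    sum (λ k → det R (replaceRow A B k))
      ≈ splitExpansion A B (λ j → sum (λ k → det R (replaceRow (minor j A) (minor j B) k)))
  sum-det-replaceRow-expand {n} A B = +-cong (reflexive (det-expand (replaceRow A B zero))) (begin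
    sum (λ k → det R (replaceRow A B (suc k)))
      ≡⟨ sum-cong-≗ (λ k → det-expand (replaceRow A B (suc k))) ⟩
    sum (λ k → sum (λ j → sgn R (toℕ j) * (A zero j * M j k)))
      ≈⟨ ∑-comm (λ k j → sgn R (toℕ j) * (A zero j * M j k)) ⟩
    sum (λ j → sum (λ k → sgn R (toℕ j) * (A zero j * M j k)))
      ≈⟨ sum-cong-≋ {x = S} (λ j → *-*-distribˡ-sum _ _ (M j)) ⟨
    sum S
      ∎)
    where
    M : Fin (suc n) → Fin n → Carrier
    M j k = det R (replaceRow (minor j A) (minor j B) k)
    S : Fin (suc n) → Carrier
    S j = sgn R (toℕ j) * (A zero j * sum (M j))

  minor-replaceCol-self : ∀ {n} (A B : Matrix (suc n)) j r s → minor j (replaceCol A B j) r s ≡ minor j A r s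
  minor-replaceCol-self A B j r s = if-cong (dec-false (j ≟ punchIn j s) (punchInᵢ≢i j s ∘ ≡.sym))

  minor-replaceCol-punchIn : ∀ {n} (A B : Matrix (suc n)) j c r s →
                             minor j (replaceCol A B (punchIn j c)) r s ≡ replaceCol (minor j A) (minor j B) c r s
  minor-replaceCol-punchIn A B j c r s =
    if-cong (does-⇔ (mk⇔ (punchIn-injective j c s) (cong (punchIn j))) (punchIn j c ≟ punchIn j s) (c ≟ s))

  sum-det-replaceCol-expand : ∀ {n} (A B : Matrix (suc n)) →
    sum (λ c → det R (replaceCol A B c))
      ≈ splitExpansion A B (λ j → sum (λ c → det R (replaceCol (minor j A) (minor j B) c)))
  sum-det-replaceCol-expand {n} A B = begin
    sum (λ c → det R (replaceCol A B c))
      ≡⟨ sum-cong-≗ (λ c → det-expand (replaceCol A B c)) ⟩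
    sum (λ c → sum (λ j → term c j))
      ≈⟨ ∑-comm term ⟩
    sum (λ j → sum (λ c → term c j))
      ≈⟨ sum-cong-≋ (λ j → sum-remove {i = j} (λ c → term c j)) ⟩
    sum (λ j → term j j + sum (λ c → term (punchIn j c) j))
      ≈⟨ ∑-distrib-+ (λ j → term j j) (λ j → sum (λ c → term (punchIn j c) j)) ⟩
    sum (λ j → term j j) + sum (λ j → sum (λ c → term (punchIn j c) j))
      ≈⟨ +-cong (sum-cong-≋ replaced) (sum-cong-≋ {y = S} kept) ⟩
    splitExpansion A B (λ j → sum (M j))
      ∎
    where
    term : Fin (suc n) → Fin (suc n) → Carrier
    term c = cofactorTerm (replaceCol A B c)
    M : Fin (suc n) → Fin n → Carrier
    M j c = det R (replaceCol (minor j A) (minor j B) c)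
    S : Fin (suc n) → Carrier
    S j = sgn R (toℕ j) * (A zero j * sum (M j))
    replaced : ∀ j → term j j ≈ sgn R (toℕ j) * (B zero j * det R (minor j A))
    replaced j = *-congˡ (*-cong (reflexive (if-cong (dec-true (j ≟ j) ≡.refl)))
                                 (det-cong (λ r s → reflexive (minor-replaceCol-self A B j r s))))
    kept : ∀ j → sum (λ c → term (punchIn j c) j) ≈ S j
    kept j = begin
      sum (λ c → term (punchIn j c) j)
        ≈⟨ sum-cong-≋ (λ c → *-congˡ (*-cong (reflexive (if-cong (dec-false (punchIn j c ≟ j) (punchInᵢ≢i j c))))
                                            (det-cong (λ r s → reflexive (minor-replaceCol-punchIn A B j c r s))))) ⟩
      sum (λ c → sgn R (toℕ j) * (A zero j * M j c))
        ≈⟨ *-*-distribˡ-sum _ _ (M j) ⟨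
      S j ∎

  sum-det-replaceRow≈sum-det-replaceCol : ∀ {n} (A B : Matrix n) →
    sum (λ k → det R (replaceRow A B k)) ≈ sum (λ c → det R (replaceCol A B c))
  sum-det-replaceRow≈sum-det-replaceCol {zero}  A B = refl
  sum-det-replaceRow≈sum-det-replaceCol {suc n} A B = begin
    sum (λ k → det R (replaceRow A B k))
      ≈⟨ sum-det-replaceRow-expand A B ⟩
    splitExpansion A B (λ j → sum (λ k → det R (replaceRow (minor j A) (minor j B) k)))
      ≈⟨ splitExpansion-cong A B (λ j → sum-det-replaceRow≈sum-det-replaceCol (minor j A) (minor j B)) ⟩
    splitExpansion A B (λ j → sum (λ c → det R (replaceCol (minor j A) (minor j B) c)))
      ≈⟨ sum-det-replaceCol-expand A B ⟨
    sum (λ c → det R (replaceCol A B c))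
      ∎

  leftColumns rightColumns : ∀ {n} → (Fin n → Fin (suc n) → Carrier) → Matrix n
  leftColumns  u i j = u i (inject₁ j)
  rightColumns u i j = u i (suc j)

  det-shift : ∀ {n} (u : Fin n → Fin (suc n) → Carrier) (b : Fin n → Fin n → Bool) →
              det R (λ i j → u i (shift j (b i j)))
                ≈ det R (λ i j → if b i j then rightColumns u i j else leftColumns u i j)
  det-shift u b = det-cong (λ i j → reflexive (if-float (u i) (b i j)))

  det-replaceCol-inject₁ : ∀ {n} (u : Fin (suc n) → Fin (suc (suc n)) → Carrier) (c : Fin n) →
                           det R (replaceCol (leftColumns u) (rightColumns u) (inject₁ c)) ≈ 0#
  det-replaceCol-inject₁ {n} u c =
    det-adjacentColumnsEqual C c (λ i → reflexive (≡.trans (replaced i) (≡.sym (kept i))))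
    where
    C : Matrix (suc n)
    C = replaceCol (leftColumns u) (rightColumns u) (inject₁ c)
    replaced : ∀ i → C i (inject₁ c) ≡ u i (suc (inject₁ c))
    replaced i = if-cong (dec-true (inject₁ c ≟ inject₁ c) ≡.refl)
    kept : ∀ i → C i (suc c) ≡ u i (suc (inject₁ c))
    kept i = if-cong (dec-false (inject₁ c ≟ suc c) (inject₁≢suc c))

lemma9p4 : {c ℓ : Level} (R : CommutativeRing c ℓ) (m : ℕ)
    (u : Fin (suc m) → Fin (suc (suc m)) → CommutativeRing.Carrier R) →
    CommutativeRing._≈_ R
    (Σ R (λ k → det R (λ i j → u i (shift j (does (k ≟ i))))))
    (det R (λ i j → u i (shift j (does (fromℕ m ≟ j)))))
lemma9p4 R m u = begin
  Σ R shiftedRow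
    ≡⟨ Σ≡sum R shiftedRow ⟩
  sum shiftedRow
    ≈⟨ sum-cong-≋ {x = shiftedRow} (λ k → det-shift R u (λ i j → does (k ≟ i))) ⟩
  sum (λ k → det R (replaceRow R A B k))
    ≈⟨ sum-det-replaceRow≈sum-det-replaceCol R A B ⟩
  sum (λ c → det R (replaceCol R A B c))
    ≈⟨ sum-init-last (λ c → det R (replaceCol R A B c)) ⟩
  sum (λ c → det R (replaceCol R A B (inject₁ c))) + det R (replaceCol R A B (fromℕ m))
    ≈⟨ +-cong (sum-zero R (det-replaceCol-inject₁ R u)) (sym (det-shift R u (λ i j → does (fromℕ m ≟ j)))) ⟩
  0# + det R (λ i j → u i (shift j (does (fromℕ m ≟ j))))
    ≈⟨ +-identityˡ _ ⟩
  det R (λ i j → u i (shift j (does (fromℕ m ≟ j))))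
    ∎
  where
  open CommutativeRing R hiding (zero)
  open import Algebra.Properties.Semiring.Sum semiring using (sum; sum-cong-≋; sum-init-last)
  open import Relation.Binary.Reasoning.Setoid setoid
  A B : Matrix R (suc m)
  A = leftColumns R u
  B = rightColumns R u
  shiftedRow : Fin (suc m) → Carrier
  shiftedRow k = det R (λ i j → u i (shift j (does (k ≟ i))))
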